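{- Let $\alpha$ be a countable ordinal, with every ordinal $\beta\le\alpha$ equipped with a fundamental sequence. If $\{\bar a^i\}_{i\in\mathbb{N}}\subseteq\mathcal{S}_\alpha$, then every limit sequence of $(\bar a^i)_{i\in\mathbb{N}}$ is also in $\mathcal{S}_\alpha$.
   Context: A fundamental sequence for a countable ordinal $\beta>0$ is a sequence of ordinals $(\beta[n])_{n\in\mathbb{N}}$ with $\beta[n]<\beta$, $\beta[n]\le\beta[n+1]$, and for every $\gamma<\beta$ some $n$ with $\gamma\le\beta[n]$; conventions $0[n]=0$ and $(\gamma+1)[n]=\gamma$. Write $\beta[c_1,\ldots,c_{m+1}]=(\beta[c_1,\ldots,c_m])[c_{m+1}]$, $\beta[\,]=\beta$. $\mathcal{S}_\alpha$ is the set of $\{0,1\}$-valued sequences $\bar a=(a_n)_{n\in\mathbb{N}}$ such that whenever $k\ge0$ and $c_1,\ldots,c_k$ satisfy: $c_1$ is least with $a_{c_1}\ne a_0$, and for each $i<k$, $c_{i+1}$ is the least value $>c_i$ with $a_{c_{i+1}}\ne a_{c_i}$, then $\alpha[c_1,\ldots,c_k]\ne0$. Given sequences $\bar a^i$, a limit sequence is a sequence $\bar b$ for which there is an infinite $S\subseteq\mathbb{N}$ such that for each $n$, $\{i\in S: a^i_n\ne b_n\}$ is finite. -}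

module Defs where

open import Data.Nat using (ℕ; zero; suc) renaming (_<_ to _<ℕ_; _≤_ to _≤ℕ_)
open import Data.Bool using (Bool)
open import Data.Unit using (⊤)
open import Data.List using (List; []; _∷_; foldl)
open import Data.Product using (_×_; ∃)
open import Relation.Binary.PropositionalEquality using (_≡_; _≢_)
open import Relation.Nullary using (¬_)

-- Countable ordinals as Brouwer trees (Kraus–Nordvall Forsberg–Xu order)

data Ord : Set where
  oz : Ord
  os : Ord → Ord
  ol : (ℕ → Ord) → Ord

infix 4 _≤_ _<_ _≈_

data _≤_ : Ord → Ord → Set where
  ≤-zero      : ∀ {x} → oz ≤ x
  ≤-trans     : ∀ {x y z} → x ≤ y → y ≤ z → x ≤ z
  ≤-succ-incr : ∀ {x} → x ≤ os x
  ≤-succ-mono : ∀ {x y} → x ≤ y → os x ≤ os y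
  ≤-cocone    : ∀ {x} (f : ℕ → Ord) (k : ℕ) → x ≤ f k → x ≤ ol f
  ≤-limiting  : ∀ {x} (f : ℕ → Ord) → (∀ k → f k ≤ x) → ol f ≤ x

_<_ : Ord → Ord → Set
x < y = os x ≤ y

_≈_ : Ord → Ord → Set
x ≈ y = (x ≤ y) × (y ≤ x)

record IsFundSeq (β : Ord) (s : ℕ → Ord) : Set where
  field
    below    : ∀ n → s n < β
    mono     : ∀ n → s n ≤ s (suc n)
    cofinal  : ∀ γ → γ < β → ∃ λ n → γ ≤ s n

-- Since Brouwer trees
-- represent ordinals non-uniquely, the assignment is required to depend
-- only on the ordinal (extensionality w.r.t. ≈).
record FundSeqSystem (α : Ord) (fs : Ord → ℕ → Ord) : Set where
  field
    fund      : ∀ β → β ≤ α → oz < β → IsFundSeq β (fs β)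
    zeroConv  : ∀ β → β ≤ α → β ≈ oz → ∀ n → fs β n ≈ oz
    succConv  : ∀ β γ → β ≤ α → β ≈ os γ → ∀ n → fs β n ≈ γ
    ext       : ∀ β β' → β ≤ α → β ≈ β' → ∀ n → fs β n ≈ fs β' n

iter : (Ord → ℕ → Ord) → Ord → List ℕ → Ord
iter fs β cs = foldl fs β cs

NextChange : (ℕ → Bool) → ℕ → ℕ → Set
NextChange a p c = (p <ℕ c) × (a c ≢ a p) × (∀ m → p <ℕ m → m <ℕ c → a m ≡ a p)

FirstChange : (ℕ → Bool) → ℕ → Set
FirstChange a c = (a c ≢ a 0) × (∀ m → m <ℕ c → a m ≡ a 0)

data ChainFrom (a : ℕ → Bool) : ℕ → List ℕ → Set where
  []  : ∀ {p} → ChainFrom a p []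
  _∷_ : ∀ {p c cs} → NextChange a p c → ChainFrom a c cs → ChainFrom a p (c ∷ cs)

ChangePoints : (ℕ → Bool) → List ℕ → Set
ChangePoints a []       = ⊤
ChangePoints a (c ∷ cs) = FirstChange a c × ChainFrom a c cs

InS : (fs : Ord → ℕ → Ord) → Ord → (ℕ → Bool) → Set
InS fs α a = ∀ cs → ChangePoints a cs → ¬ (iter fs α cs ≈ oz)

Infinite : (ℕ → Set) → Set
Infinite S = ∀ m → ∃ λ i → (m ≤ℕ i) × S i

IsLimitSeq : (ℕ → ℕ → Bool) → (ℕ → Bool) → Set₁
IsLimitSeq as b = ∃ λ (S : ℕ → Set) → Infinite S ×
  (∀ n → ∃ λ N → ∀ i → S i → as i n ≢ b n → i <ℕ N)

-- Whether c₁,…,c_k are the first k change points of a sequence depends only on the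
-- sequence up to c_k.  A limit sequence b agrees with some aⁱ on any finite prefix,
-- so a list of change points of b witnessing b ∉ S_α would witness aⁱ ∉ S_α.
module Submission where

open import Defs
open import Data.Nat using (ℕ; zero; suc; _⊔_; z≤n; s≤s⁻¹) renaming (_≤_ to _≤ℕ_)
open import Data.Nat.Properties using (m≤m⊔n; m≤n⊔m; <⇒≤; <⇒≱; m≤n⇒m<n∨m≡n) renaming (≤-trans to ≤ℕ-trans; ≤-refl to ≤ℕ-refl)
open import Data.Bool using (Bool)
open import Data.Bool.Properties using () renaming (_≟_ to _≟B_)
open import Data.List using (List; []; _∷_)
open import Data.List.Extrema.Nat using (max; xs≤max)
open import Data.List.Relation.Unary.All using (All; []; _∷_)
open import Data.Product using (_,_; ∃; proj₁; proj₂)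
open import Data.Sum using (inj₁; inj₂)
open import Relation.Binary.PropositionalEquality using (_≡_; refl; sym; trans)
open import Relation.Nullary.Decidable using (decidable-stable)

AgreeUpTo : (ℕ → Bool) → (ℕ → Bool) → ℕ → Set
AgreeUpTo a b M = ∀ {m} → m ≤ℕ M → a m ≡ b m

module _ {a b : ℕ → Bool} where

  agreeUpTo-mono : ∀ {M N} → N ≤ℕ M → AgreeUpTo a b M → AgreeUpTo a b N
  agreeUpTo-mono N≤M agree m≤N = agree (≤ℕ-trans m≤N N≤M)

  nextChange-transfer : ∀ {p c} → AgreeUpTo a b c → NextChange b p c → NextChange a p c
  nextChange-transfer agree (p<c , bc≢bp , b-const) =
    p<c ,
    (λ ac≡ap → bc≢bp (trans (sym (agree ≤ℕ-refl)) (trans ac≡ap (agree p≤c)))) ,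
    λ m p<m m<c → trans (agree (<⇒≤ m<c)) (trans (b-const m p<m m<c) (sym (agree p≤c)))
    where p≤c = <⇒≤ p<c

  firstChange-transfer : ∀ {c} → AgreeUpTo a b c → FirstChange b c → FirstChange a c
  firstChange-transfer agree (bc≢b0 , b-const) =
    (λ ac≡a0 → bc≢b0 (trans (sym (agree ≤ℕ-refl)) (trans ac≡a0 (agree z≤n)))) ,
    λ m m<c → trans (agree (<⇒≤ m<c)) (trans (b-const m m<c) (sym (agree z≤n)))

  chainFrom-transfer : ∀ {M p cs} → AgreeUpTo a b M → All (_≤ℕ M) cs →
                       ChainFrom b p cs → ChainFrom a p cs
  chainFrom-transfer agree []           []           = []
  chainFrom-transfer agree (c≤M ∷ cs≤M) (next ∷ chain) =
    nextChange-transfer (agreeUpTo-mono c≤M agree) next ∷ chainFrom-transfer agree cs≤M chain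

  changePoints-transfer : ∀ {M} cs → AgreeUpTo a b M → All (_≤ℕ M) cs →
                          ChangePoints b cs → ChangePoints a cs
  changePoints-transfer []       agree []           _               = _
  changePoints-transfer (c ∷ cs) agree (c≤M ∷ cs≤M) (first , chain) =
    firstChange-transfer (agreeUpTo-mono c≤M agree) first , chainFrom-transfer agree cs≤M chain

maxUpTo : (ℕ → ℕ) → ℕ → ℕ
maxUpTo N zero    = N zero
maxUpTo N (suc M) = maxUpTo N M ⊔ N (suc M)

≤-maxUpTo : ∀ (N : ℕ → ℕ) M {n} → n ≤ℕ M → N n ≤ℕ maxUpTo N M
≤-maxUpTo N zero    z≤n = ≤ℕ-refl
≤-maxUpTo N (suc M) n≤1+M with m≤n⇒m<n∨m≡n n≤1+M
... | inj₁ n<1+M = ≤ℕ-trans (≤-maxUpTo N M (s≤s⁻¹ n<1+M)) (m≤m⊔n _ _)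
... | inj₂ refl  = m≤n⊔m _ _

-- Past the largest of the exception bounds for n ≤ M, every member of S agrees with b up to M.
limitSeq-agreesUpTo : ∀ {as b} → IsLimitSeq as b → ∀ M → ∃ λ i → AgreeUpTo (as i) b M
limitSeq-agreesUpTo {as} {b} (S , infinite , bounded) M
  with infinite (maxUpTo (λ n → proj₁ (bounded n)) M)
... | i , bound≤i , i∈S = i , λ {m} m≤M →
  decidable-stable (as i m ≟B b m) λ aim≢bm →
    <⇒≱ (proj₂ (bounded m) i i∈S aim≢bm)
        (≤ℕ-trans (≤-maxUpTo (λ n → proj₁ (bounded n)) M m≤M) bound≤i)

mainTheorem6 : (α : Ord) (fs : Ord → ℕ → Ord) → FundSeqSystem α fs →
    (as : ℕ → ℕ → Bool) → (∀ i → InS fs α (as i)) →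
    (b : ℕ → Bool) → IsLimitSeq as b → InS fs α b
mainTheorem6 α fs _ as as∈S b limit cs changes
  with limitSeq-agreesUpTo limit (max 0 cs)
... | i , agree = as∈S i cs (changePoints-transfer cs agree (xs≤max 0 cs) changes)
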